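{- Let $G$ be a $C_3$-free graph with maximum degree at most 3 and let $a^*,d^*:V(G)\to\{0,1\}$. Then $(G,a^*,d^*)$ is a YES-instance of $(1,1)$-Cluster Editing if and only if there is a matching $D$ of deletable edges of $G$ such that every connected component $C$ of $G-D$ is isomorphic to $P_1$, $P_2$, $P_3$ or $C_4$, where if $C\cong P_3$ then the non-edge of $G$ between the end-vertices of $C$ is addable, and if $C\cong C_4$ then both chords of $C$ (which are non-edges of $G$) are addable.
   Context: An edge $uv$ of $G$ is deletable if $d^*(u)=d^*(v)=1$; a non-edge $uv$ of $G$ is addable if $a^*(u)=a^*(v)=1$. $(G,a^*,d^*)$ is a YES-instance of $(1,1)$-Cluster Editing if there is a matching $D$ of deletable edges and a matching $A$ of addable non-edges such that $G-D+A$ is a vertex-disjoint union of cliques. $P_n$ is the path on $n$ vertices, $C_4$ the cycle on 4 vertices. $C_3$-free means containing no 3-cycle as a subgraph. -}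

module Defs where

open import Data.Nat using (ℕ; _≤_)
open import Data.Fin using (Fin)
open import Data.Bool using (Bool; true; false; if_then_else_)
open import Data.List using (List; map; allFin)
open import Data.Nat.ListAction using (sum)
open import Data.Product using (Σ; ∃; ∃-syntax; _×_; _,_)
open import Data.Sum using (_⊎_)
open import Data.Empty using (⊥)
open import Relation.Nullary using (¬_)
open import Relation.Binary.PropositionalEquality using (_≡_; _≢_)
open import Relation.Binary.Construct.Closure.ReflexiveTransitive using (Star)

record Graph (n : ℕ) : Set where
  field
    adj   : Fin n → Fin n → Bool
    sym   : ∀ u v → adj u v ≡ adj v u
    irrefl : ∀ v → adj v v ≡ false
open Graph public

Edge : ∀ {n} → Graph n → Fin n → Fin n → Set
Edge G u v = adj G u v ≡ true

degree : ∀ {n} → Graph n → Fin n → ℕ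
degree {n} G v = sum (map (λ u → if adj G v u then 1 else 0) (allFin n))

MaxDegreeAtMost : ∀ {n} → Graph n → ℕ → Set
MaxDegreeAtMost G k = ∀ v → degree G v ≤ k

C3-free : ∀ {n} → Graph n → Set
C3-free G = ∀ u v w → Edge G u v → Edge G v w → Edge G u w → ⊥

-- Labelling V(G) → {0,1}, with 1 represented by true.
Label : ℕ → Set
Label n = Fin n → Bool

-- A set of vertex pairs (unordered: required to be symmetric)
EdgeSet : ℕ → Set₁
EdgeSet n = Fin n → Fin n → Set

Symmetric : ∀ {n} → EdgeSet n → Set
Symmetric F = ∀ {u v} → F u v → F v u

Matching : ∀ {n} → EdgeSet n → Set
Matching F = Symmetric F × (∀ {u v w} → F u v → F u w → v ≡ w)

Deletable : ∀ {n} → Graph n → Label n → Fin n → Fin n → Set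
Deletable G d u v = Edge G u v × d u ≡ true × d v ≡ true

Addable : ∀ {n} → Graph n → Label n → Fin n → Fin n → Set
Addable G a u v = u ≢ v × ¬ Edge G u v × a u ≡ true × a v ≡ true

AdjMinus : ∀ {n} → Graph n → EdgeSet n → Fin n → Fin n → Set
AdjMinus G D u v = Edge G u v × ¬ D u v

AdjEdit : ∀ {n} → Graph n → EdgeSet n → EdgeSet n → Fin n → Fin n → Set
AdjEdit G D A u v = AdjMinus G D u v ⊎ A u v

-- a graph (given by a symmetric irreflexive adjacency) is a vertex-disjoint
-- union of cliques iff adjacency is transitive on distinct vertices
IsClusterGraph : ∀ {n} → (Fin n → Fin n → Set) → Set
IsClusterGraph H = ∀ u v w → H u v → H v w → u ≢ w → H u w

YES-instance-11 : ∀ {n} → Graph n → Label n → Label n → Set₁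
YES-instance-11 {n} G a d =
  Σ (EdgeSet n) λ D → Σ (EdgeSet n) λ A →
    Matching D × (∀ {u v} → D u v → Deletable G d u v) ×
    Matching A × (∀ {u v} → A u v → Addable G a u v) ×
    IsClusterGraph (AdjEdit G D A)

Reach : ∀ {n} → Graph n → EdgeSet n → Fin n → Fin n → Set
Reach G D = Star (AdjMinus G D)

CompIs1 : ∀ {n} → Graph n → EdgeSet n → Fin n → Fin n → Set
CompIs1 G D v x = Reach G D v x × (∀ u → Reach G D v u → u ≡ x)

CompIs2 : ∀ {n} → Graph n → EdgeSet n → Fin n → Fin n → Fin n → Set
CompIs2 G D v x y = Reach G D v x × Reach G D v y ×
  (∀ u → Reach G D v u → u ≡ x ⊎ u ≡ y)

CompIs3 : ∀ {n} → Graph n → EdgeSet n → Fin n → Fin n → Fin n → Fin n → Set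
CompIs3 G D v x y z = Reach G D v x × Reach G D v y × Reach G D v z ×
  (∀ u → Reach G D v u → u ≡ x ⊎ u ≡ y ⊎ u ≡ z)

CompIs4 : ∀ {n} → Graph n → EdgeSet n → Fin n → Fin n → Fin n → Fin n → Fin n → Set
CompIs4 G D v w x y z = Reach G D v w × Reach G D v x × Reach G D v y × Reach G D v z ×
  (∀ u → Reach G D v u → u ≡ w ⊎ u ≡ x ⊎ u ≡ y ⊎ u ≡ z)

CompP1 : ∀ {n} → Graph n → EdgeSet n → Fin n → Set
CompP1 G D v = CompIs1 G D v v

CompP2 : ∀ {n} → Graph n → EdgeSet n → Fin n → Set
CompP2 G D v = ∃[ x ] ∃[ y ] CompIs2 G D v x y × x ≢ y × AdjMinus G D x y

CompP3 : ∀ {n} → Graph n → Label n → EdgeSet n → Fin n → Set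
CompP3 G a D v = ∃[ x ] ∃[ y ] ∃[ z ] CompIs3 G D v x y z ×
  (x ≢ y × y ≢ z × x ≢ z) ×
  AdjMinus G D x y × AdjMinus G D y z × ¬ AdjMinus G D x z ×
  Addable G a x z

CompC4 : ∀ {n} → Graph n → Label n → EdgeSet n → Fin n → Set
CompC4 G a D v = ∃[ w ] ∃[ x ] ∃[ y ] ∃[ z ] CompIs4 G D v w x y z ×
  (w ≢ x × w ≢ y × w ≢ z × x ≢ y × x ≢ z × y ≢ z) ×
  AdjMinus G D w x × AdjMinus G D x y × AdjMinus G D y z × AdjMinus G D z w ×
  ¬ AdjMinus G D w y × ¬ AdjMinus G D x z ×
  Addable G a w y × Addable G a x z

GoodDeletion : ∀ {n} → Graph n → Label n → Label n → Set₁
GoodDeletion {n} G a d =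
  Σ (EdgeSet n) λ D →
    Matching D × (∀ {u v} → D u v → Deletable G d u v) ×
    (∀ v → CompP1 G D v ⊎ CompP2 G D v ⊎ CompP3 G a D v ⊎ CompC4 G a D v)

{-# OPTIONS --safe #-}
module Submission where

-- Let H = G − D + A be a cluster graph and write R for the edges of G − D. Two distinct
-- R-neighbours of a vertex lie in one clique of H but are not R-adjacent (G is triangle-free),
-- so they are partners in the matching A; and partners in A have the same R-neighbours.
-- Hence a vertex v has at most two R-neighbours, and looking at the neighbourhoods of v and of
-- its R-neighbours shows that the component of v in G − D is a P1, P2, P3 or C4 whose
-- chords lie in A. Conversely, if every component has this shape, adding its addable chords
-- gives a cluster graph in which each vertex gains at most one edge.
--
-- D and A are arbitrary predicates, whereas the case analysis needs R to be decidable. So the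
-- forward direction first replaces D and A by Boolean matrices: such matrices exist up to a
-- double negation, and since there are finitely many, an exhaustive search removes it.

open import Defs
open import Data.Nat using (ℕ; zero; suc)
open import Data.Product using (_×_; _,_; proj₁; proj₂; ∃; ∃-syntax; map₂)
open import Data.Sum using (_⊎_; inj₁; inj₂; [_,_]′; swap)
import Data.Sum as Sum
open import Data.Empty using (⊥-elim)
open import Data.Bool using (Bool; true; T)
import Data.Bool.Properties as Bool
open import Data.Fin using (Fin; zero; suc)
open import Data.Fin.Properties using (_≟_; any?; all?)
open import Data.Fin.Subset.Properties using (anySubset?)
open import Data.Vec using (Vec; []; _∷_; lookup; tabulate)
open import Data.Vec.Properties using (lookup∘tabulate)
open import Level using (0ℓ)
open import Function using (_∘_; flip; id)
open import Relation.Nullary using (¬_; Dec; yes; no)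
open import Relation.Nullary.Decidable
  using (map′; _×-dec_; _⊎-dec_; _→-dec_; ¬?; T?; isYes; toWitness; fromWitness;
         decidable-stable; ¬¬-excluded-middle)
open import Relation.Unary using (Pred; Decidable)
open import Relation.Binary.Core using (_⇒_; _⇔_)
open import Relation.Binary.Definitions using () renaming (Decidable to Decidable₂)
open import Relation.Binary.PropositionalEquality using (_≡_; _≢_; refl; trans; cong; subst)
import Relation.Binary.PropositionalEquality as ≡
open import Relation.Binary.Construct.Closure.ReflexiveTransitive using (ε; _◅_; _◅◅_; reverse)

module _ {n : ℕ} (G : Graph n) where

  Edge-sym : ∀ {u v} → Edge G u v → Edge G v u
  Edge-sym {u} {v} = trans (sym G v u)

  Edge⇒≢ : ∀ {u v} → Edge G u v → u ≢ v
  Edge⇒≢ {u} e refl with () ← trans (≡.sym e) (irrefl G u)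

  Addable-sym : ∀ {a u v} → Addable G a u v → Addable G a v u
  Addable-sym (u≢v , ¬e , au , av) = u≢v ∘ ≡.sym , ¬e ∘ Edge-sym , av , au

module Components {n : ℕ} (G : Graph n) (a : Label n) (D : EdgeSet n) (D-sym : Symmetric D) where

  R : Fin n → Fin n → Set
  R = AdjMinus G D

  R-sym : ∀ {u v} → R u v → R v u
  R-sym (e , ¬d) = Edge-sym G e , ¬d ∘ D-sym

  R⇒≢ : ∀ {u v} → R u v → u ≢ v
  R⇒≢ = Edge⇒≢ G ∘ proj₁

  R⇒¬Addable : ∀ {u v} → R u v → ¬ Addable G a u v
  R⇒¬Addable (e , _) (_ , ¬e , _) = ¬e e

  Reach-sym : ∀ {u v} → Reach G D u v → Reach G D v u
  Reach-sym = reverse R-sym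

  Reach-closed : ∀ {S : Fin n → Set} {v} → S v → (∀ {p u} → S p → R p u → S u) →
                 ∀ u → Reach G D v u → S u
  Reach-closed sv closed _ ε = sv
  Reach-closed sv closed u (r ◅ rs) = Reach-closed (closed sv r) closed u rs

  GoodComponent : Fin n → Set
  GoodComponent v = CompP1 G D v ⊎ CompP2 G D v ⊎ CompP3 G a D v ⊎ CompC4 G a D v

  -- The neighbours of u in G − D + A, plus u itself, when p is the partner of u in A.
  data ClusterMate (u p : Fin n) : Fin n → Set where
    itself    : ClusterMate u p u
    neighbour : ∀ {t} → R u t → ClusterMate u p t
    partner   : Addable G a u p → ClusterMate u p p

  CompletableOn : (Fin n → Set) → Set
  CompletableOn S = ∀ {u} → S u → ∃[ p ] (∀ {t} → S t → ClusterMate u p t)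

  Completable : Fin n → Set
  Completable v = ∃[ p ] (∀ t → Reach G D v t → ClusterMate v p t)

  single-completable : ∀ {x} → CompletableOn (_≡ x)
  single-completable {x} refl = x , λ { refl → itself }

  edge-completable : ∀ {x y} → R x y → CompletableOn (λ t → t ≡ x ⊎ t ≡ y)
  edge-completable {x} rxy (inj₁ refl) = x , λ
    { (inj₁ refl) → itself ; (inj₂ refl) → neighbour rxy }
  edge-completable {y = y} rxy (inj₂ refl) = y , λ
    { (inj₁ refl) → neighbour (R-sym rxy) ; (inj₂ refl) → itself }

  path-completable : ∀ {x y z} → R x y → R y z → Addable G a x z →
                     CompletableOn (λ t → t ≡ x ⊎ t ≡ y ⊎ t ≡ z)
  path-completable rxy ryz axz (inj₁ refl) = _ , λ
    { (inj₁ refl) → itself ; (inj₂ (inj₁ refl)) → neighbour rxy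
    ; (inj₂ (inj₂ refl)) → partner axz }
  path-completable {y = y} rxy ryz axz (inj₂ (inj₁ refl)) = y , λ
    { (inj₁ refl) → neighbour (R-sym rxy) ; (inj₂ (inj₁ refl)) → itself
    ; (inj₂ (inj₂ refl)) → neighbour ryz }
  path-completable rxy ryz axz (inj₂ (inj₂ refl)) = _ , λ
    { (inj₁ refl) → partner (Addable-sym G axz) ; (inj₂ (inj₁ refl)) → neighbour (R-sym ryz)
    ; (inj₂ (inj₂ refl)) → itself }

  square-completable : ∀ {w x y z} → R w x → R x y → R y z → R z w →
                       Addable G a w y → Addable G a x z →
                       CompletableOn (λ t → t ≡ w ⊎ t ≡ x ⊎ t ≡ y ⊎ t ≡ z)
  square-completable rwx rxy ryz rzw awy axz (inj₁ refl) = _ , λ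
    { (inj₁ refl) → itself ; (inj₂ (inj₁ refl)) → neighbour rwx
    ; (inj₂ (inj₂ (inj₁ refl))) → partner awy ; (inj₂ (inj₂ (inj₂ refl))) → neighbour (R-sym rzw) }
  square-completable rwx rxy ryz rzw awy axz (inj₂ (inj₁ refl)) = _ , λ
    { (inj₁ refl) → neighbour (R-sym rwx) ; (inj₂ (inj₁ refl)) → itself
    ; (inj₂ (inj₂ (inj₁ refl))) → neighbour rxy ; (inj₂ (inj₂ (inj₂ refl))) → partner axz }
  square-completable rwx rxy ryz rzw awy axz (inj₂ (inj₂ (inj₁ refl))) = _ , λ
    { (inj₁ refl) → partner (Addable-sym G awy) ; (inj₂ (inj₁ refl)) → neighbour (R-sym rxy)
    ; (inj₂ (inj₂ (inj₁ refl))) → itself ; (inj₂ (inj₂ (inj₂ refl))) → neighbour ryz }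
  square-completable rwx rxy ryz rzw awy axz (inj₂ (inj₂ (inj₂ refl))) = _ , λ
    { (inj₁ refl) → neighbour rzw ; (inj₂ (inj₁ refl)) → partner (Addable-sym G axz)
    ; (inj₂ (inj₂ (inj₁ refl))) → neighbour (R-sym ryz) ; (inj₂ (inj₂ (inj₂ refl))) → itself }

  component-completable : ∀ {S v} → CompletableOn S → (∀ t → Reach G D v t → S t) → Completable v
  component-completable completable within = map₂ (λ mate t r → mate (within t r)) (completable (within _ ε))

  goodComponent⇒completable : ∀ {v} → GoodComponent v → Completable v
  goodComponent⇒completable (inj₁ (_ , within)) =
    component-completable single-completable within
  goodComponent⇒completable (inj₂ (inj₁ (_ , _ , (_ , _ , within) , _ , rxy))) =
    component-completable (edge-completable rxy) within
  goodComponent⇒completable (inj₂ (inj₂ (inj₁ (_ , _ , _ , (_ , _ , _ , within) , _ , rxy , ryz , _ , axz)))) =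
    component-completable (path-completable rxy ryz axz) within
  goodComponent⇒completable
    (inj₂ (inj₂ (inj₂ (_ , _ , _ , _ , (_ , _ , _ , _ , within) , _ ,
                       rwx , rxy , ryz , rzw , _ , _ , awy , axz)))) =
    component-completable (square-completable rwx rxy ryz rzw awy axz) within

  completable⇒yes : ∀ {d} → Matching D → D ⇒ Deletable G d →
                    (∀ v → Completable v) → YES-instance-11 G a d
  completable⇒yes D-matching D-deletable completable =
    D , A , D-matching , D-deletable , (A-sym , A-functional) , proj₂ , cluster
    where
    A : EdgeSet n
    A u v = Reach G D u v × Addable G a u v

    A-sym : Symmetric A
    A-sym (r , ad) = Reach-sym r , Addable-sym G ad

    addable-mate-is-partner : ∀ {u p t} → ClusterMate u p t → Addable G a u t → t ≡ p
    addable-mate-is-partner itself (u≢u , _) = ⊥-elim (u≢u refl)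
    addable-mate-is-partner (neighbour r) ad = ⊥-elim (R⇒¬Addable r ad)
    addable-mate-is-partner (partner _) _ = refl

    A-functional : ∀ {u v w} → A u v → A u w → v ≡ w
    A-functional {u} (rv , av) (rw , aw) =
      let (_ , mate) = completable u
      in trans (addable-mate-is-partner (mate _ rv) av) (≡.sym (addable-mate-is-partner (mate _ rw) aw))

    edit⇒Reach : ∀ {u v} → AdjEdit G D A u v → Reach G D u v
    edit⇒Reach (inj₁ r) = r ◅ ε
    edit⇒Reach (inj₂ (r , _)) = r

    mate⇒edit : ∀ {u p t} → Reach G D u t → u ≢ t → ClusterMate u p t → AdjEdit G D A u t
    mate⇒edit _ u≢u itself = ⊥-elim (u≢u refl)
    mate⇒edit _ _ (neighbour r) = inj₁ r
    mate⇒edit r _ (partner ad) = inj₂ (r , ad)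

    cluster : IsClusterGraph (AdjEdit G D A)
    cluster u _ w huv hvw u≢w = mate⇒edit ruw u≢w (proj₂ (completable u) w ruw)
      where
      ruw : Reach G D u w
      ruw = edit⇒Reach huv ◅◅ edit⇒Reach hvw

  OnlyNbr : Fin n → Fin n → Set
  OnlyNbr p s = ∀ {u} → R p u → u ≡ s

  OnlyNbrs : Fin n → Fin n → Fin n → Set
  OnlyNbrs p s t = ∀ {u} → R p u → u ≡ s ⊎ u ≡ t

  data LocalShape (v : Fin n) : Set where
    isolated    : (∀ {u} → ¬ R v u) → LocalShape v
    edge        : ∀ {x} → R v x → OnlyNbr v x → OnlyNbr x v → LocalShape v
    path-end    : ∀ {x w} → R v x → R x w →
                  OnlyNbr v x → OnlyNbrs x v w → OnlyNbr w x → Addable G a v w → LocalShape v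
    path-middle : ∀ {x y} → R v x → R v y →
                  OnlyNbrs v x y → OnlyNbr x v → OnlyNbr y v → Addable G a x y → LocalShape v
    square      : ∀ {x w y} → R v x → R x w → R w y → R y v →
                  OnlyNbrs v x y → OnlyNbrs x v w → OnlyNbrs w x y → OnlyNbrs y v w →
                  Addable G a v w → Addable G a x y → LocalShape v

  localShape⇒good : ∀ {v} → LocalShape v → GoodComponent v
  localShape⇒good {v} (isolated none) = inj₁ (ε , Reach-closed refl closed)
    where
    closed : ∀ {p u} → p ≡ v → R p u → u ≡ v
    closed refl r = ⊥-elim (none r)
  localShape⇒good {v} (edge {x} rvx only-v only-x) =
    inj₂ (inj₁ (v , x , (ε , rvx ◅ ε , Reach-closed (inj₁ refl) closed) , R⇒≢ rvx , rvx))
    where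
    closed : ∀ {p u} → p ≡ v ⊎ p ≡ x → R p u → u ≡ v ⊎ u ≡ x
    closed (inj₁ refl) r = inj₂ (only-v r)
    closed (inj₂ refl) r = inj₁ (only-x r)
  localShape⇒good {v} (path-end {x} {w} rvx rxw only-v only-x only-w avw) =
    inj₂ (inj₂ (inj₁ (v , x , w , (ε , rvx ◅ ε , rvx ◅ rxw ◅ ε , Reach-closed (inj₁ refl) closed) ,
      (R⇒≢ rvx , R⇒≢ rxw , proj₁ avw) , rvx , rxw , (λ r → R⇒¬Addable r avw) , avw)))
    where
    closed : ∀ {p u} → p ≡ v ⊎ p ≡ x ⊎ p ≡ w → R p u → u ≡ v ⊎ u ≡ x ⊎ u ≡ w
    closed (inj₁ refl) r = inj₂ (inj₁ (only-v r))
    closed (inj₂ (inj₁ refl)) r = Sum.map₂ inj₂ (only-x r)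
    closed (inj₂ (inj₂ refl)) r = inj₂ (inj₁ (only-w r))
  localShape⇒good {v} (path-middle {x} {y} rvx rvy only-v only-x only-y axy) =
    inj₂ (inj₂ (inj₁ (x , v , y , (rvx ◅ ε , ε , rvy ◅ ε , Reach-closed (inj₂ (inj₁ refl)) closed) ,
      (R⇒≢ (R-sym rvx) , R⇒≢ rvy , proj₁ axy) , R-sym rvx , rvy , (λ r → R⇒¬Addable r axy) , axy)))
    where
    closed : ∀ {p u} → p ≡ x ⊎ p ≡ v ⊎ p ≡ y → R p u → u ≡ x ⊎ u ≡ v ⊎ u ≡ y
    closed (inj₁ refl) r = inj₂ (inj₁ (only-x r))
    closed (inj₂ (inj₁ refl)) r = Sum.map₂ inj₂ (only-v r)
    closed (inj₂ (inj₂ refl)) r = inj₂ (inj₁ (only-y r))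
  localShape⇒good {v} (square {x} {w} {y} rvx rxw rwy ryv only-v only-x only-w only-y avw axy) =
    inj₂ (inj₂ (inj₂ (v , x , w , y ,
      (ε , rvx ◅ ε , rvx ◅ rxw ◅ ε , R-sym ryv ◅ ε , Reach-closed (inj₁ refl) closed) ,
      (R⇒≢ rvx , proj₁ avw , R⇒≢ (R-sym ryv) , R⇒≢ rxw , proj₁ axy , R⇒≢ rwy) ,
      rvx , rxw , rwy , ryv , (λ r → R⇒¬Addable r avw) , (λ r → R⇒¬Addable r axy) , avw , axy)))
    where
    closed : ∀ {p u} → p ≡ v ⊎ p ≡ x ⊎ p ≡ w ⊎ p ≡ y → R p u →
             u ≡ v ⊎ u ≡ x ⊎ u ≡ w ⊎ u ≡ y
    closed (inj₁ refl) r = [ inj₂ ∘ inj₁ , inj₂ ∘ inj₂ ∘ inj₂ ]′ (only-v r)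
    closed (inj₂ (inj₁ refl)) r = [ inj₁ , inj₂ ∘ inj₂ ∘ inj₁ ]′ (only-x r)
    closed (inj₂ (inj₂ (inj₁ refl))) r = [ inj₂ ∘ inj₁ , inj₂ ∘ inj₂ ∘ inj₂ ]′ (only-w r)
    closed (inj₂ (inj₂ (inj₂ refl))) r = [ inj₁ , inj₂ ∘ inj₂ ∘ inj₁ ]′ (only-y r)

module ClusterEditing {n : ℕ} (G : Graph n) (a : Label n) (D A : EdgeSet n)
  (D-sym : Symmetric D) (A-matching : Matching A) (A-addable : A ⇒ Addable G a)
  (cluster : IsClusterGraph (AdjEdit G D A)) (triangle-free : C3-free G)
  (R? : Decidable₂ (AdjMinus G D)) where

  open Components G a D D-sym

  A-sym : ∀ {u v} → A u v → A v u
  A-sym = proj₁ A-matching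

  A-unique : ∀ {u v w} → A u v → A u w → v ≡ w
  A-unique = proj₂ A-matching

  A⇒¬R : ∀ {u v} → A u v → ¬ R u v
  A⇒¬R auv r = R⇒¬Addable r (A-addable auv)

  common-nbr⇒A : ∀ {u v w} → R u v → R v w → u ≢ w → A u w
  common-nbr⇒A ruv rvw u≢w with cluster _ _ _ (inj₁ ruv) (inj₁ rvw) u≢w
  ... | inj₁ ruw = ⊥-elim (triangle-free _ _ _ (proj₁ ruv) (proj₁ rvw) (proj₁ ruw))
  ... | inj₂ auw = auw

  partners-share-nbrs : ∀ {v w u} → A v w → R w u → R v u
  partners-share-nbrs {v} {w} {u} avw rwu =
    [ id , ⊥-elim ∘ R⇒≢ rwu ∘ A-unique avw ]′ (cluster _ _ _ (inj₂ avw) (inj₁ rwu) v≢u)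
    where
    v≢u : v ≢ u
    v≢u refl = A⇒¬R avw (R-sym rwu)

  onlyNbrs-of-nbr : ∀ {v x w} → R v x → A v w → OnlyNbrs x v w
  onlyNbrs-of-nbr {v} rvx avw {u} rxu with u ≟ v
  ... | yes u≡v = inj₁ u≡v
  ... | no u≢v = inj₂ (A-unique (common-nbr⇒A rvx rxu (u≢v ∘ ≡.sym)) avw)

  OtherNbr : Fin n → Fin n → Set
  OtherNbr p s = ∃[ u ] (R p u × u ≢ s)

  otherNbr? : ∀ p s → Dec (OtherNbr p s)
  otherNbr? p s = any? λ u → R? p u ×-dec ¬? (u ≟ s)

  no-other⇒OnlyNbr : ∀ {p s} → ¬ OtherNbr p s → OnlyNbr p s
  no-other⇒OnlyNbr {s = s} none {u} rpu = decidable-stable (u ≟ s) λ u≢s → none (u , rpu , u≢s)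

  square-via : ∀ {v x y w} → R v x → R v y → OnlyNbrs v x y → A x y → R x w → w ≢ v → LocalShape v
  square-via {v} {x} {y} {w} rvx rvy only-v axy rxw w≢v =
    square rvx rxw (R-sym ryw) (R-sym rvy) only-v (onlyNbrs-of-nbr rvx avw) (only-v ∘ partners-share-nbrs avw)
      (onlyNbrs-of-nbr rvy avw) (A-addable avw) (A-addable axy)
    where
    avw : A v w
    avw = common-nbr⇒A rvx rxw (w≢v ∘ ≡.sym)
    ryw : R y w
    ryw = partners-share-nbrs (A-sym axy) rxw

  two-nbrs⇒localShape : ∀ {v x y} → R v x → R v y → y ≢ x → LocalShape v
  two-nbrs⇒localShape {v} {x} {y} rvx rvy y≢x = shape (otherNbr? x v) (otherNbr? y v)
    where
    axy : A x y
    axy = common-nbr⇒A (R-sym rvx) rvy (y≢x ∘ ≡.sym)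
    only-v : OnlyNbrs v x y
    only-v = onlyNbrs-of-nbr (R-sym rvx) axy

    shape : Dec (OtherNbr x v) → Dec (OtherNbr y v) → LocalShape v
    shape (yes (w , rxw , w≢v)) _ = square-via rvx rvy only-v axy rxw w≢v
    shape (no _) (yes (w , ryw , w≢v)) = square-via rvy rvx (swap ∘ only-v) (A-sym axy) ryw w≢v
    shape (no none-x) (no none-y) =
      path-middle rvx rvy only-v (no-other⇒OnlyNbr none-x) (no-other⇒OnlyNbr none-y) (A-addable axy)

  one-nbr⇒localShape : ∀ {v x} → R v x → OnlyNbr v x → LocalShape v
  one-nbr⇒localShape {v} {x} rvx only-v with otherNbr? x v
  ... | no none = edge rvx only-v (no-other⇒OnlyNbr none)
  ... | yes (w , rxw , w≢v) =
    path-end rvx rxw only-v (onlyNbrs-of-nbr rvx avw) (only-v ∘ partners-share-nbrs avw) (A-addable avw)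
    where
    avw : A v w
    avw = common-nbr⇒A rvx rxw (w≢v ∘ ≡.sym)

  localShape : ∀ v → LocalShape v
  localShape v with any? (R? v)
  ... | no none = isolated λ {u} r → none (u , r)
  ... | yes (x , rvx) with otherNbr? v x
  ...   | no none = one-nbr⇒localShape rvx (no-other⇒OnlyNbr none)
  ...   | yes (y , rvy , y≢x) = two-nbrs⇒localShape rvx rvy y≢x

  goodComponent : ∀ v → GoodComponent v
  goodComponent = localShape⇒good ∘ localShape

YesWitness : ∀ {n} → Graph n → Label n → Label n → EdgeSet n → EdgeSet n → Set
YesWitness G a d D A =
  Matching D × (D ⇒ Deletable G d) × Matching A × (A ⇒ Addable G a) × IsClusterGraph (AdjEdit G D A)

module _ {n : ℕ} where

  Matching-resp : ∀ {F F′ : EdgeSet n} → F ⇔ F′ → Matching F → Matching F′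
  Matching-resp (to , from) (F-sym , F-unique) = to ∘ F-sym ∘ from , λ p q → F-unique (from p) (from q)

  IsClusterGraph-resp : ∀ {H H′ : Fin n → Fin n → Set} → H ⇔ H′ →
                        IsClusterGraph H → IsClusterGraph H′
  IsClusterGraph-resp (to , from) cluster u v w huv hvw u≢w = to (cluster u v w (from huv) (from hvw) u≢w)

  AdjEdit-resp : ∀ {G : Graph n} {D D′ A A′} → D ⇔ D′ → A ⇔ A′ →
                 AdjEdit G D A ⇔ AdjEdit G D′ A′
  AdjEdit-resp (D-to , D-from) (A-to , A-from) =
    Sum.map (map₂ (_∘ D-from)) A-to , Sum.map (map₂ (_∘ D-to)) A-from

  YesWitness-resp : ∀ {G : Graph n} {a d D D′ A A′} → D ⇔ D′ → A ⇔ A′ →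
                    YesWitness G a d D A → YesWitness G a d D′ A′
  YesWitness-resp {G = G} D⇔D′ A⇔A′ (D-matching , D-deletable , A-matching , A-addable , cluster) =
    Matching-resp D⇔D′ D-matching , D-deletable ∘ proj₂ D⇔D′ ,
    Matching-resp A⇔A′ A-matching , A-addable ∘ proj₂ A⇔A′ ,
    IsClusterGraph-resp (AdjEdit-resp {G = G} D⇔D′ A⇔A′) cluster

  ⇒? : ∀ {F P : EdgeSet n} → Decidable₂ F → Decidable₂ P → Dec (F ⇒ P)
  ⇒? F? P? = map′ (λ f {u} {v} → f u v) (λ f u v → f) (all? λ u → all? λ v → F? u v →-dec P? u v)

  Matching? : ∀ {F : EdgeSet n} → Decidable₂ F → Dec (Matching F)
  Matching? F? = ⇒? F? (flip F?) ×-dec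
    map′ (λ f {u} {v} {w} → f u v w) (λ f u v w → f)
      (all? λ u → all? λ v → all? λ w → F? u v →-dec F? u w →-dec v ≟ w)

  IsClusterGraph? : ∀ {H : Fin n → Fin n → Set} → Decidable₂ H → Dec (IsClusterGraph H)
  IsClusterGraph? H? =
    all? λ u → all? λ v → all? λ w → H? u v →-dec H? v w →-dec ¬? (u ≟ w) →-dec H? u w

  Edge? : (G : Graph n) → Decidable₂ (Edge G)
  Edge? G u v = adj G u v Bool.≟ true

  YesWitness? : ∀ (G : Graph n) {a d D A} → Decidable₂ D → Decidable₂ A → Dec (YesWitness G a d D A)
  YesWitness? G {a} {d} D? A? =
    Matching? D? ×-dec ⇒? D? Deletable? ×-dec Matching? A? ×-dec ⇒? A? Addable? ×-dec
    IsClusterGraph? λ u v → (Edge? G u v ×-dec ¬? (D? u v)) ⊎-dec A? u v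
    where
    Deletable? : Decidable₂ (Deletable G d)
    Deletable? u v = Edge? G u v ×-dec (d u Bool.≟ true) ×-dec (d v Bool.≟ true)
    Addable? : Decidable₂ (Addable G a)
    Addable? u v = ¬? (u ≟ v) ×-dec ¬? (Edge? G u v) ×-dec (a u Bool.≟ true) ×-dec (a v Bool.≟ true)

  BoolRel : Set
  BoolRel = Vec (Vec Bool n) n

  ⟦_⟧ : BoolRel → EdgeSet n
  ⟦ M ⟧ u v = T (lookup (lookup M u) v)

  ⟦_⟧? : ∀ M → Decidable₂ ⟦ M ⟧
  ⟦ M ⟧? u v = T? _

  encode : ∀ {F : EdgeSet n} → Decidable₂ F → BoolRel
  encode F? = tabulate λ u → tabulate λ v → isYes (F? u v)

  encode-correct : ∀ {F : EdgeSet n} (F? : Decidable₂ F) → F ⇔ ⟦ encode F? ⟧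
  encode-correct F? = (λ f → subst T (≡.sym entry) (fromWitness f)) , λ t → toWitness (subst T entry t)
    where
    entry : ∀ {u v} → lookup (lookup (encode F?) u) v ≡ isYes (F? u v)
    entry {u} {v} = trans (cong (flip lookup v) (lookup∘tabulate _ u)) (lookup∘tabulate _ v)

anyVec? : ∀ {A : Set} → (∀ {P : Pred A 0ℓ} → Decidable P → Dec (∃ P)) →
          ∀ {m} {P : Pred (Vec A m) 0ℓ} → Decidable P → Dec (∃ P)
anyVec? anyA? {zero} P? = map′ ([] ,_) (λ { ([] , p) → p }) (P? [])
anyVec? anyA? {suc m} P? =
  map′ (λ (x , xs , p) → x ∷ xs , p) (λ { (x ∷ xs , p) → x , xs , p })
    (anyA? λ x → anyVec? anyA? λ xs → P? (x ∷ xs))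

anyBoolRel? : ∀ {n} {P : Pred (BoolRel {n}) 0ℓ} → Decidable P → Dec (∃ P)
anyBoolRel? = anyVec? anySubset?

¬¬-∀-Fin : ∀ {m} {P : Fin m → Set} → (∀ i → ¬ ¬ P i) → ¬ ¬ (∀ i → P i)
¬¬-∀-Fin {zero} _ k = k λ ()
¬¬-∀-Fin {suc m} ¬¬p k =
  ¬¬p zero λ p₀ → ¬¬-∀-Fin (¬¬p ∘ suc) λ ps → k λ { zero → p₀ ; (suc i) → ps i }

¬¬-Decidable₂ : ∀ {n} (F : EdgeSet n) → ¬ ¬ Decidable₂ F
¬¬-Decidable₂ F = ¬¬-∀-Fin λ u → ¬¬-∀-Fin λ v → ¬¬-excluded-middle

yesWitness⇒goodDeletion : ∀ {n} (G : Graph n) (a d : Label n) {D A} → C3-free G → Decidable₂ D →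
                          YesWitness G a d D A → GoodDeletion G a d
yesWitness⇒goodDeletion G a d {D} {A} triangle-free D?
  (D-matching , D-deletable , A-matching , A-addable , cluster) =
  D , D-matching , D-deletable , goodComponent
  where
  R? : Decidable₂ (AdjMinus G D)
  R? u v = Edge? G u v ×-dec ¬? (D? u v)
  open ClusterEditing G a D A (proj₁ D-matching) A-matching A-addable cluster triangle-free R?

BooleanYes : ∀ {n} → Graph n → Label n → Label n → Set
BooleanYes G a d = ∃[ MD ] ∃[ MA ] YesWitness G a d ⟦ MD ⟧ ⟦ MA ⟧

yes⇒booleanYes : ∀ {n} (G : Graph n) (a d : Label n) → YES-instance-11 G a d → BooleanYes G a d
yes⇒booleanYes G a d (D , A , w) = decidable-stable booleanYes? ¬¬booleanYes
  where
  booleanYes? : Dec (BooleanYes G a d)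
  booleanYes? = anyBoolRel? λ MD → anyBoolRel? λ MA → YesWitness? G ⟦ MD ⟧? ⟦ MA ⟧?
  ¬¬booleanYes : ¬ ¬ BooleanYes G a d
  ¬¬booleanYes k = ¬¬-Decidable₂ D λ D? → ¬¬-Decidable₂ A λ A? →
    k (encode D? , encode A? , YesWitness-resp {G = G} {a} {d} (encode-correct D?) (encode-correct A?) w)

lemma11 : ∀ {n} (G : Graph n) (a d : Label n) →
    C3-free G → MaxDegreeAtMost G 3 →
    (YES-instance-11 G a d → GoodDeletion G a d) × (GoodDeletion G a d → YES-instance-11 G a d)
lemma11 G a d triangle-free _ = forward , backward
  where
  forward : YES-instance-11 G a d → GoodDeletion G a d
  forward yes-instance with yes⇒booleanYes G a d yes-instance
  ... | MD , _ , witness = yesWitness⇒goodDeletion G a d triangle-free ⟦ MD ⟧? witness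
  backward : GoodDeletion G a d → YES-instance-11 G a d
  backward (D , D-matching , D-deletable , good) =
    completable⇒yes D-matching D-deletable (goodComponent⇒completable ∘ good)
    where open Components G a D (proj₁ D-matching)
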